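{- Let $\varphi$ be a pattern and $x,y$ element variables such that $x$ does not occur bound in $\varphi$ and $y$ does not occur in $\varphi$. Then in $\mathcal{MG}^c$: (i) $\vdash\forall x\varphi\to\forall y\,\mathrm{Subf}_x^y\varphi$; (ii) $\vdash\forall y\,\mathrm{Subf}_x^y\varphi\to\forall x\varphi$; (iii) $\vdash\forall x\varphi\leftrightarrow\forall y\,\mathrm{Subf}_x^y\varphi$.
   Context: Fix a countably infinite set $EVar$ of element variables and a set $\Sigma$ of constant symbols containing a distinguished "definedness symbol" $\lceil\,\rceil$. Patterns: $\varphi::= x\mid \sigma\mid \bot\mid \neg\varphi\mid \varphi\to\varphi\mid \varphi\wedge\varphi\mid\varphi\vee\varphi\mid \varphi\cdot\varphi\mid \forall x\varphi\mid\exists x\varphi$ ($\varphi\cdot\psi$ is application). Abbreviations: $\varphi\leftrightarrow\psi:=(\varphi\to\psi)\wedge(\psi\to\varphi)$, $\lceil\varphi\rceil:=\lceil\,\rceil\cdot\varphi$, $\lfloor\varphi\rfloor:=\neg\lceil\neg\varphi\rceil$, $\varphi=\psi:=\lfloor\varphi\leftrightarrow\psi\rfloor$. An occurrence of $x$ is bound if inside a subpattern $\forall x\eta$ or $\exists x\eta$, otherwise free. $\mathrm{Subf}_x^y\varphi$ is the result of replacing every free occurrence of $x$ in $\varphi$ by $y$. $\vdash\psi$ means there is a finite sequence ending in $\psi$ of axiom instances or consequences of earlier members by rules. Proof system $\mathcal{MG}^c$. Axioms: $\varphi\vee\varphi\to\varphi$; $\varphi\to\varphi\wedge\varphi$; $\varphi\to\varphi\vee\psi$;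 $\varphi\wedge\psi\to\varphi$; $\varphi\vee\psi\to\psi\vee\varphi$; $\varphi\wedge\psi\to\psi\wedge\varphi$; $\bot\to\varphi$; $\varphi\vee\neg\varphi$; $\neg\varphi\to(\varphi\to\bot)$; $(\varphi\to\bot)\to\neg\varphi$; $\forall x(\varphi\to\psi)\to(\forall x\varphi\to\forall x\psi)$; $\varphi\to\forall x\varphi$ if $x$ does not occur in $\varphi$; $\exists x(x=y)$ for $y$ distinct from $x$; $\exists x\varphi\to\neg\forall x\neg\varphi$; $\neg\forall x\neg\varphi\to\exists x\varphi$; $(\varphi\vee\psi)\cdot\chi\to\varphi\cdot\chi\vee\psi\cdot\chi$; $\chi\cdot(\varphi\vee\psi)\to\chi\cdot\varphi\vee\chi\cdot\psi$; $(\exists x\varphi)\cdot\psi\to\exists x(\varphi\cdot\psi)$ and $\psi\cdot(\exists x\varphi)\to\exists x(\psi\cdot\varphi)$ if $x$ does not occur in $\psi$; $\lceil\varphi\rceil\cdot\psi\to\lceil\varphi\rceil$; $\psi\cdot\lceil\varphi\rceil\to\lceil\varphi\rceil$; $\lceil x\rceil$; $\varphi\to\lceil\varphi\rceil$; $\lceil\bot\rceil\to\bot$. Rules: from $\varphi$, $\varphi\to\psi$ infer $\psi$; from $\varphi\to\psi$, $\psi\to\chi$ infer $\varphi\to\chi$; from $\varphi\wedge\psi\to\chi$ infer $\varphi\to(\psi\to\chi)$; from $\varphi\to(\psi\to\chi)$ infer $\varphi\wedge\psi\to\chi$; from $\varphi\to\psi$ infer $\chi\vee\varphi\to\chi\vee\psi$;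 from $\varphi$ infer $\forall x\varphi$; from $\varphi\to\psi$ infer $\varphi\cdot\chi\to\psi\cdot\chi$ and $\chi\cdot\varphi\to\chi\cdot\psi$. -}

module Defs where

open import Data.Nat using (ℕ; _≟_)
open import Data.Bool using (Bool; true; false; if_then_else_)
open import Relation.Nullary using (¬_; does)
open import Relation.Binary.PropositionalEquality using (_≡_)
open import Data.Product using (_×_)

EVar : Set
EVar = ℕ

module MG (Sym : Set) (defd : Sym) where

  infixr 5 _⇒_
  infixl 7 _∧ₚ_
  infixl 6 _∨ₚ_
  infixl 9 _·_

  data Pattern : Set where
    var  : EVar → Pattern
    sym  : Sym → Pattern
    ⊥ₚ   : Pattern
    ¬ₚ_  : Pattern → Pattern
    _⇒_  : Pattern → Pattern → Pattern
    _∧ₚ_ : Pattern → Pattern → Pattern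
    _∨ₚ_ : Pattern → Pattern → Pattern
    _·_  : Pattern → Pattern → Pattern
    all  : EVar → Pattern → Pattern
    ex   : EVar → Pattern → Pattern

  _⇔_ : Pattern → Pattern → Pattern
  φ ⇔ ψ = (φ ⇒ ψ) ∧ₚ (ψ ⇒ φ)

  ⌈_⌉ : Pattern → Pattern
  ⌈ φ ⌉ = sym defd · φ

  ⌊_⌋ : Pattern → Pattern
  ⌊ φ ⌋ = ¬ₚ ⌈ ¬ₚ φ ⌉

  _≐_ : Pattern → Pattern → Pattern
  φ ≐ ψ = ⌊ φ ⇔ ψ ⌋

  data Occurs (x : EVar) : Pattern → Set where
    o-var  : Occurs x (var x)
    o-¬    : ∀ {φ} → Occurs x φ → Occurs x (¬ₚ φ)
    o-⇒l   : ∀ {φ ψ} → Occurs x φ → Occurs x (φ ⇒ ψ)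
    o-⇒r   : ∀ {φ ψ} → Occurs x ψ → Occurs x (φ ⇒ ψ)
    o-∧l   : ∀ {φ ψ} → Occurs x φ → Occurs x (φ ∧ₚ ψ)
    o-∧r   : ∀ {φ ψ} → Occurs x ψ → Occurs x (φ ∧ₚ ψ)
    o-∨l   : ∀ {φ ψ} → Occurs x φ → Occurs x (φ ∨ₚ ψ)
    o-∨r   : ∀ {φ ψ} → Occurs x ψ → Occurs x (φ ∨ₚ ψ)
    o-·l   : ∀ {φ ψ} → Occurs x φ → Occurs x (φ · ψ)
    o-·r   : ∀ {φ ψ} → Occurs x ψ → Occurs x (φ · ψ)
    o-allb : ∀ {φ} → Occurs x (all x φ)
    o-exb  : ∀ {φ} → Occurs x (ex x φ)
    o-all  : ∀ {z φ} → Occurs x φ → Occurs x (all z φ)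
    o-ex   : ∀ {z φ} → Occurs x φ → Occurs x (ex z φ)

  data OccursBound (x : EVar) : Pattern → Set where
    b-¬    : ∀ {φ} → OccursBound x φ → OccursBound x (¬ₚ φ)
    b-⇒l   : ∀ {φ ψ} → OccursBound x φ → OccursBound x (φ ⇒ ψ)
    b-⇒r   : ∀ {φ ψ} → OccursBound x ψ → OccursBound x (φ ⇒ ψ)
    b-∧l   : ∀ {φ ψ} → OccursBound x φ → OccursBound x (φ ∧ₚ ψ)
    b-∧r   : ∀ {φ ψ} → OccursBound x ψ → OccursBound x (φ ∧ₚ ψ)
    b-∨l   : ∀ {φ ψ} → OccursBound x φ → OccursBound x (φ ∨ₚ ψ)
    b-∨r   : ∀ {φ ψ} → OccursBound x ψ → OccursBound x (φ ∨ₚ ψ)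
    b-·l   : ∀ {φ ψ} → OccursBound x φ → OccursBound x (φ · ψ)
    b-·r   : ∀ {φ ψ} → OccursBound x ψ → OccursBound x (φ · ψ)
    b-allb : ∀ {φ} → OccursBound x (all x φ)
    b-exb  : ∀ {φ} → OccursBound x (ex x φ)
    b-all  : ∀ {z φ} → OccursBound x φ → OccursBound x (all z φ)
    b-ex   : ∀ {z φ} → OccursBound x φ → OccursBound x (ex z φ)

  Subf : EVar → EVar → Pattern → Pattern
  Subf x y (var z) = if does (z ≟ x) then var y else var z
  Subf x y (sym s) = sym s
  Subf x y ⊥ₚ = ⊥ₚ
  Subf x y (¬ₚ φ) = ¬ₚ Subf x y φ
  Subf x y (φ ⇒ ψ) = Subf x y φ ⇒ Subf x y ψ
  Subf x y (φ ∧ₚ ψ) = Subf x y φ ∧ₚ Subf x y ψ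
  Subf x y (φ ∨ₚ ψ) = Subf x y φ ∨ₚ Subf x y ψ
  Subf x y (φ · ψ) = Subf x y φ · Subf x y ψ
  Subf x y (all z φ) = if does (z ≟ x) then all z φ else all z (Subf x y φ)
  Subf x y (ex z φ) = if does (z ≟ x) then ex z φ else ex z (Subf x y φ)

  data ⊢_ : Pattern → Set where
    ax-∨idem  : ∀ {φ} → ⊢ (φ ∨ₚ φ ⇒ φ)
    ax-∧dup   : ∀ {φ} → ⊢ (φ ⇒ φ ∧ₚ φ)
    ax-∨intro : ∀ {φ ψ} → ⊢ (φ ⇒ φ ∨ₚ ψ)
    ax-∧elim  : ∀ {φ ψ} → ⊢ (φ ∧ₚ ψ ⇒ φ)
    ax-∨comm  : ∀ {φ ψ} → ⊢ (φ ∨ₚ ψ ⇒ ψ ∨ₚ φ)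
    ax-∧comm  : ∀ {φ ψ} → ⊢ (φ ∧ₚ ψ ⇒ ψ ∧ₚ φ)
    ax-⊥      : ∀ {φ} → ⊢ (⊥ₚ ⇒ φ)
    ax-lem    : ∀ {φ} → ⊢ (φ ∨ₚ ¬ₚ φ)
    ax-¬elim  : ∀ {φ} → ⊢ (¬ₚ φ ⇒ (φ ⇒ ⊥ₚ))
    ax-¬intro : ∀ {φ} → ⊢ ((φ ⇒ ⊥ₚ) ⇒ ¬ₚ φ)
    ax-∀dist  : ∀ {x φ ψ} → ⊢ (all x (φ ⇒ ψ) ⇒ (all x φ ⇒ all x ψ))
    ax-∀vac   : ∀ {x φ} → ¬ Occurs x φ → ⊢ (φ ⇒ all x φ)
    ax-exeq   : ∀ {x y} → ¬ (x ≡ y) → ⊢ ex x (var x ≐ var y)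
    ax-∃→¬∀¬  : ∀ {x φ} → ⊢ (ex x φ ⇒ ¬ₚ all x (¬ₚ φ))
    ax-¬∀¬→∃  : ∀ {x φ} → ⊢ (¬ₚ all x (¬ₚ φ) ⇒ ex x φ)
    ax-prop∨l : ∀ {φ ψ χ} → ⊢ ((φ ∨ₚ ψ) · χ ⇒ φ · χ ∨ₚ ψ · χ)
    ax-prop∨r : ∀ {φ ψ χ} → ⊢ (χ · (φ ∨ₚ ψ) ⇒ χ · φ ∨ₚ χ · ψ)
    ax-prop∃l : ∀ {x φ ψ} → ¬ Occurs x ψ → ⊢ ((ex x φ) · ψ ⇒ ex x (φ · ψ))
    ax-prop∃r : ∀ {x φ ψ} → ¬ Occurs x ψ → ⊢ (ψ · (ex x φ) ⇒ ex x (ψ · φ))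
    ax-⌈⌉l    : ∀ {φ ψ} → ⊢ (⌈ φ ⌉ · ψ ⇒ ⌈ φ ⌉)
    ax-⌈⌉r    : ∀ {φ ψ} → ⊢ (ψ · ⌈ φ ⌉ ⇒ ⌈ φ ⌉)
    ax-defvar : ∀ {x} → ⊢ ⌈ var x ⌉
    ax-def    : ∀ {φ} → ⊢ (φ ⇒ ⌈ φ ⌉)
    ax-def⊥   : ⊢ (⌈ ⊥ₚ ⌉ ⇒ ⊥ₚ)
    mp        : ∀ {φ ψ} → ⊢ φ → ⊢ (φ ⇒ ψ) → ⊢ ψ
    syl       : ∀ {φ ψ χ} → ⊢ (φ ⇒ ψ) → ⊢ (ψ ⇒ χ) → ⊢ (φ ⇒ χ)
    exp       : ∀ {φ ψ χ} → ⊢ (φ ∧ₚ ψ ⇒ χ) → ⊢ (φ ⇒ (ψ ⇒ χ))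
    imp       : ∀ {φ ψ χ} → ⊢ (φ ⇒ (ψ ⇒ χ)) → ⊢ (φ ∧ₚ ψ ⇒ χ)
    ∨-mono    : ∀ {φ ψ χ} → ⊢ (φ ⇒ ψ) → ⊢ (χ ∨ₚ φ ⇒ χ ∨ₚ ψ)
    gen       : ∀ {x φ} → ⊢ φ → ⊢ all x φ
    frame-l   : ∀ {φ ψ χ} → ⊢ (φ ⇒ ψ) → ⊢ (φ · χ ⇒ ψ · χ)
    frame-r   : ∀ {φ ψ χ} → ⊢ (φ ⇒ ψ) → ⊢ (χ · φ ⇒ χ · ψ)

{-# OPTIONS --safe #-}
-- Inside MGᶜ, the equation x = y entails φ ↔ φ[y/x] when x is not bound and y
-- does not occur in φ.  This is proved by induction on φ: a binder ∀z or ∃z is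
-- crossed by generalising over z, which does not occur in x = y, and an
-- application is crossed because a floor ⌊P⌋ can be pushed into any
-- application context (its negation ⌈¬P⌉ escapes every context).  There is no
-- instantiation axiom, so ∀x φ is instantiated at y through ∃x (x = y): it yields
-- ∃x φ[y/x], from which the vacuous ∃x is dropped.  Generalising over y gives
-- ∀x φ → ∀y φ[y/x], and the converse is the same argument with the roles of φ and
-- φ[y/x] exchanged.
module Submission where

open import Defs
open import Data.Bool using (true; false)
open import Data.Empty using (⊥-elim)
open import Data.Nat using (_≟_)
open import Data.Product using (_×_; _,_; proj₁; proj₂)
open import Function using (_∘_)
open import Relation.Nullary using (¬_; does; proof; yes; no)
open import Relation.Nullary.Reflects using (ofʸ; ofⁿ)
open import Relation.Binary.PropositionalEquality using (_≡_; _≢_; refl; cong; cong₂; ≢-sym)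

module _ {Sym : Set} {defd : Sym} where
  open MG Sym defd

  private
    variable
      A A′ B B′ C E P Q X : Pattern
      x y z : EVar

  ⇒-refl : ⊢ (A ⇒ A)
  ⇒-refl = syl ax-∧dup ax-∧elim

  ⇒-const : ⊢ A → ⊢ (C ⇒ A)
  ⇒-const a = mp a (exp ax-∧elim)

  ⇒-flip : ⊢ (A ⇒ (B ⇒ C)) → ⊢ (B ⇒ (A ⇒ C))
  ⇒-flip h = exp (syl ax-∧comm (imp h))

  ⇒-contract : ⊢ (C ⇒ (C ⇒ A)) → ⊢ (C ⇒ A)
  ⇒-contract h = syl ax-∧dup (imp h)

  ⇒-mp : ⊢ (C ⇒ A) → ⊢ (C ⇒ (A ⇒ B)) → ⊢ (C ⇒ B)
  ⇒-mp a h = ⇒-contract (syl a (⇒-flip h))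

  ⇒-mapˡ : ⊢ (A′ ⇒ A) → ⊢ (C ⇒ (A ⇒ B)) → ⊢ (C ⇒ (A′ ⇒ B))
  ⇒-mapˡ f h = ⇒-flip (syl f (⇒-flip h))

  ⇒-mapʳ : ⊢ (B ⇒ B′) → ⊢ (C ⇒ (A ⇒ B)) → ⊢ (C ⇒ (A ⇒ B′))
  ⇒-mapʳ f h = exp (syl (imp h) f)

  ∧-elimʳ : ⊢ (A ∧ₚ B ⇒ B)
  ∧-elimʳ = syl ax-∧comm ax-∧elim

  ∧-intro : ⊢ (C ⇒ A) → ⊢ (C ⇒ B) → ⊢ (C ⇒ A ∧ₚ B)
  ∧-intro a b = ⇒-mp b (syl a (exp ⇒-refl))

  ⇔-intro : ⊢ (A ⇒ B) → ⊢ (B ⇒ A) → ⊢ (A ⇔ B)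
  ⇔-intro f g = mp g (mp f (exp ⇒-refl))

  ∨-introʳ : ⊢ (B ⇒ A ∨ₚ B)
  ∨-introʳ = syl ax-∨intro ax-∨comm

  ∨-elim : ⊢ (A ⇒ C) → ⊢ (B ⇒ C) → ⊢ (A ∨ₚ B ⇒ C)
  ∨-elim f g = syl (∨-mono g) (syl ax-∨comm (syl (∨-mono f) ax-∨idem))

  ∨-cases : ⊢ (C ⇒ A ∨ₚ B) → ⊢ (C ∧ₚ A ⇒ X) → ⊢ (C ∧ₚ B ⇒ X) → ⊢ (C ⇒ X)
  ∨-cases h f g = ⇒-contract (syl h (∨-elim (⇒-flip (exp f)) (⇒-flip (exp g))))

  contradiction : ⊢ (C ⇒ P) → ⊢ (C ⇒ ¬ₚ P) → ⊢ (C ⇒ Q)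
  contradiction p ¬p = syl (⇒-mp p (syl ¬p ax-¬elim)) ax-⊥

  ¬¬-elim : ⊢ (¬ₚ ¬ₚ A ⇒ A)
  ¬¬-elim = ∨-cases (⇒-const ax-lem) ∧-elimʳ (syl (imp ax-¬elim) ax-⊥)

  excluded-middle-∧ : ⊢ (A ⇒ (Q ∧ₚ A) ∨ₚ ¬ₚ Q)
  excluded-middle-∧ = ∨-cases (⇒-const ax-lem) (syl ax-∧comm ax-∨intro) (syl ∧-elimʳ ∨-introʳ)

  disjunctive-syllogism : ⊢ (X ⇒ A ∨ₚ P) → ⊢ (¬ₚ P ∧ₚ X ⇒ A)
  disjunctive-syllogism h =
    ∨-cases (syl ∧-elimʳ h) ∧-elimʳ (contradiction ∧-elimʳ (syl ax-∧elim ax-∧elim))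

  -- A superscript ᴴ marks a rule that holds under an extra hypothesis E.

  ¬-antitoneᴴ : ⊢ (E ⇒ (A ⇒ B)) → ⊢ (E ⇒ (¬ₚ B ⇒ ¬ₚ A))
  ¬-antitoneᴴ {E = E} {A = A} {B = B} h = exp (syl (exp (contradiction b (syl ax-∧elim ∧-elimʳ))) ax-¬intro)
    where
    b : ⊢ ((E ∧ₚ ¬ₚ B) ∧ₚ A ⇒ B)
    b = ⇒-mp ∧-elimʳ (syl (syl ax-∧elim ax-∧elim) h)

  contraposition : ⊢ (A ⇒ B) → ⊢ (¬ₚ B ⇒ ¬ₚ A)
  contraposition f = ⇒-contract (¬-antitoneᴴ (⇒-const f))

  ⇒-monoᴴ : ⊢ (E ⇒ (A′ ⇒ A)) → ⊢ (E ⇒ (B ⇒ B′)) → ⊢ (E ⇒ ((A ⇒ B) ⇒ (A′ ⇒ B′)))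
  ⇒-monoᴴ {E = E} {A′ = A′} {A = A} {B = B} f g = exp (exp (⇒-mp b (syl e g)))
    where
    e : ⊢ ((E ∧ₚ (A ⇒ B)) ∧ₚ A′ ⇒ E)
    e = syl ax-∧elim ax-∧elim
    a : ⊢ ((E ∧ₚ (A ⇒ B)) ∧ₚ A′ ⇒ A)
    a = ⇒-mp ∧-elimʳ (syl e f)
    b : ⊢ ((E ∧ₚ (A ⇒ B)) ∧ₚ A′ ⇒ B)
    b = ⇒-mp a (syl ax-∧elim ∧-elimʳ)

  ∧-monoᴴ : ⊢ (E ⇒ (A ⇒ A′)) → ⊢ (E ⇒ (B ⇒ B′)) → ⊢ (E ⇒ (A ∧ₚ B ⇒ A′ ∧ₚ B′))
  ∧-monoᴴ f g = exp (∧-intro (⇒-mp (syl ∧-elimʳ ax-∧elim) (syl ax-∧elim f))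
                             (⇒-mp (syl ∧-elimʳ ∧-elimʳ) (syl ax-∧elim g)))

  ∨-monoᴴ : ⊢ (E ⇒ (A ⇒ A′)) → ⊢ (E ⇒ (B ⇒ B′)) → ⊢ (E ⇒ (A ∨ₚ B ⇒ A′ ∨ₚ B′))
  ∨-monoᴴ {E = E} {A = A} {B = B} f g =
    exp (∨-cases ∧-elimʳ (syl (⇒-mp ∧-elimʳ (syl e f)) ax-∨intro)
                         (syl (⇒-mp ∧-elimʳ (syl e g)) ∨-introʳ))
    where
    e : ∀ {D} → ⊢ ((E ∧ₚ (A ∨ₚ B)) ∧ₚ D ⇒ E)
    e = syl ax-∧elim ax-∧elim

  ∀-mono : ⊢ (A ⇒ B) → ⊢ (all z A ⇒ all z B)
  ∀-mono f = mp (gen f) ax-∀dist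

  ∃-dist : ⊢ (all z (A ⇒ B) ⇒ (ex z A ⇒ ex z B))
  ∃-dist = ⇒-mapˡ ax-∃→¬∀¬ (⇒-mapʳ ax-¬∀¬→∃ (¬-antitoneᴴ ∀¬-dist))
    where
    ∀¬-dist : ⊢ (all z (A ⇒ B) ⇒ (all z (¬ₚ B) ⇒ all z (¬ₚ A)))
    ∀¬-dist = syl (∀-mono (¬-antitoneᴴ ⇒-refl)) ax-∀dist

  ∀-monoᴴ : ¬ Occurs z E → ⊢ (E ⇒ (A ⇒ A′)) → ⊢ (E ⇒ (all z A ⇒ all z A′))
  ∀-monoᴴ z∉E f = syl (ax-∀vac z∉E) (syl (∀-mono f) ax-∀dist)

  ∃-monoᴴ : ¬ Occurs z E → ⊢ (E ⇒ (A ⇒ A′)) → ⊢ (E ⇒ (ex z A ⇒ ex z A′))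
  ∃-monoᴴ z∉E f = syl (ax-∀vac z∉E) (syl (∀-mono f) ∃-dist)

  ∃-vacuous : ¬ Occurs z A → ⊢ (ex z A ⇒ A)
  ∃-vacuous z∉A = syl ax-∃→¬∀¬ (syl (contraposition (ax-∀vac λ { (o-¬ o) → z∉A o })) ¬¬-elim)

  -- ∀x A and ∃x (x = y) give ∃x B, whose quantifier is vacuous.
  ∀-inst : x ≢ y → ¬ Occurs x B → ⊢ ((var x ≐ var y) ⇒ (A ⇒ B)) → ⊢ (all x A ⇒ B)
  ∀-inst x≢y x∉B h =
    syl (⇒-mp (⇒-const (ax-exeq x≢y)) (syl (∀-mono (⇒-flip h)) ∃-dist)) (∃-vacuous x∉B)

  ⌊⌋-elim : ⊢ (⌊ A ⌋ ⇒ A)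
  ⌊⌋-elim = syl (contraposition ax-def) ¬¬-elim

  ⌊⌋-mono : ⊢ (A ⇒ B) → ⊢ (⌊ A ⌋ ⇒ ⌊ B ⌋)
  ⌊⌋-mono f = contraposition (frame-r (contraposition f))

  ≐-elimˡ : ⊢ ((A ≐ B) ⇒ (A ⇒ B))
  ≐-elimˡ = syl ⌊⌋-elim ax-∧elim

  ≐-elimʳ : ⊢ ((A ≐ B) ⇒ (B ⇒ A))
  ≐-elimʳ = syl ⌊⌋-elim ∧-elimʳ

  ≐-sym : ⊢ ((A ≐ B) ⇒ (B ≐ A))
  ≐-sym = ⌊⌋-mono ax-∧comm

  -- Split on ⌊P⌋; in the other case ⌈¬P⌉ absorbs the application context.
  ⌊⌋-frameˡ : ⊢ (⌊ P ⌋ ∧ₚ (A · B) ⇒ (⌊ P ⌋ ∧ₚ A) · B)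
  ⌊⌋-frameˡ = disjunctive-syllogism
    (syl (frame-l excluded-middle-∧) (syl ax-prop∨l (∨-mono (syl (frame-l ¬¬-elim) ax-⌈⌉l))))

  ⌊⌋-frameʳ : ⊢ (⌊ P ⌋ ∧ₚ (B · A) ⇒ B · (⌊ P ⌋ ∧ₚ A))
  ⌊⌋-frameʳ = disjunctive-syllogism
    (syl (frame-r excluded-middle-∧) (syl ax-prop∨r (∨-mono (syl (frame-r ¬¬-elim) ax-⌈⌉r))))

  ·-monoᴴ : ⊢ (⌊ P ⌋ ⇒ (A ⇒ A′)) → ⊢ (⌊ P ⌋ ⇒ (B ⇒ B′)) → ⊢ (⌊ P ⌋ ⇒ (A · B ⇒ A′ · B′))
  ·-monoᴴ f g = exp (syl (∧-intro ax-∧elim (syl ⌊⌋-frameˡ (frame-l (imp f))))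
                         (syl ⌊⌋-frameʳ (frame-r (imp g))))

  ∉-≐ : z ≢ x → z ≢ y → ¬ Occurs z (var x ≐ var y)
  ∉-≐ z≢x z≢y (o-¬ (o-·r (o-¬ (o-∧l (o-⇒l o-var))))) = z≢x refl
  ∉-≐ z≢x z≢y (o-¬ (o-·r (o-¬ (o-∧l (o-⇒r o-var))))) = z≢y refl
  ∉-≐ z≢x z≢y (o-¬ (o-·r (o-¬ (o-∧r (o-⇒l o-var))))) = z≢y refl
  ∉-≐ z≢x z≢y (o-¬ (o-·r (o-¬ (o-∧r (o-⇒r o-var))))) = z≢x refl

  ∉-all : z ≢ x → ¬ Occurs z A → ¬ Occurs z (all x A)
  ∉-all z≢x z∉A o-allb    = z≢x refl
  ∉-all z≢x z∉A (o-all o) = z∉A o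

  -- Subf tests does (z ≟ x), which computes to z ≡ᵇ x, so a plain with z ≟ x would
  -- not abstract it; splitting on does and proof separately does.
  Subf-self : ∀ x (φ : Pattern) → Subf x x φ ≡ φ
  Subf-self x (var z) with does (z ≟ x) | proof (z ≟ x)
  ... | true  | ofʸ refl = refl
  ... | false | _        = refl
  Subf-self x (sym s)  = refl
  Subf-self x ⊥ₚ       = refl
  Subf-self x (¬ₚ φ)   = cong ¬ₚ_ (Subf-self x φ)
  Subf-self x (φ ⇒ ψ)  = cong₂ _⇒_ (Subf-self x φ) (Subf-self x ψ)
  Subf-self x (φ ∧ₚ ψ) = cong₂ _∧ₚ_ (Subf-self x φ) (Subf-self x ψ)
  Subf-self x (φ ∨ₚ ψ) = cong₂ _∨ₚ_ (Subf-self x φ) (Subf-self x ψ)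
  Subf-self x (φ · ψ)  = cong₂ _·_ (Subf-self x φ) (Subf-self x ψ)
  Subf-self x (all z φ) with does (z ≟ x)
  ... | true  = refl
  ... | false = cong (all z) (Subf-self x φ)
  Subf-self x (ex z φ) with does (z ≟ x)
  ... | true  = refl
  ... | false = cong (ex z) (Subf-self x φ)

  ∉-Subf : (φ : Pattern) → x ≢ y → ¬ OccursBound x φ → ¬ Occurs x (Subf x y φ)
  ∉-Subf {x} (var z) x≢y _ with does (z ≟ x) | proof (z ≟ x)
  ... | true  | ofʸ refl = λ { o-var → x≢y refl }
  ... | false | ofⁿ z≢x  = λ { o-var → z≢x refl }
  ∉-Subf (¬ₚ φ)   x≢y x∉b (o-¬ o)  = ∉-Subf φ x≢y (x∉b ∘ b-¬) o
  ∉-Subf (φ ⇒ ψ)  x≢y x∉b (o-⇒l o) = ∉-Subf φ x≢y (x∉b ∘ b-⇒l) o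
  ∉-Subf (φ ⇒ ψ)  x≢y x∉b (o-⇒r o) = ∉-Subf ψ x≢y (x∉b ∘ b-⇒r) o
  ∉-Subf (φ ∧ₚ ψ) x≢y x∉b (o-∧l o) = ∉-Subf φ x≢y (x∉b ∘ b-∧l) o
  ∉-Subf (φ ∧ₚ ψ) x≢y x∉b (o-∧r o) = ∉-Subf ψ x≢y (x∉b ∘ b-∧r) o
  ∉-Subf (φ ∨ₚ ψ) x≢y x∉b (o-∨l o) = ∉-Subf φ x≢y (x∉b ∘ b-∨l) o
  ∉-Subf (φ ∨ₚ ψ) x≢y x∉b (o-∨r o) = ∉-Subf ψ x≢y (x∉b ∘ b-∨r) o
  ∉-Subf (φ · ψ)  x≢y x∉b (o-·l o) = ∉-Subf φ x≢y (x∉b ∘ b-·l) o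
  ∉-Subf (φ · ψ)  x≢y x∉b (o-·r o) = ∉-Subf ψ x≢y (x∉b ∘ b-·r) o
  ∉-Subf {x} (all z φ) x≢y x∉b with does (z ≟ x) | proof (z ≟ x)
  ... | true  | ofʸ refl = ⊥-elim (x∉b b-allb)
  ... | false | ofⁿ z≢x  = ∉-all (≢-sym z≢x) (∉-Subf φ x≢y (x∉b ∘ b-all))
  ∉-Subf {x} (ex z φ) x≢y x∉b with does (z ≟ x) | proof (z ≟ x)
  ... | true  | ofʸ refl = ⊥-elim (x∉b b-exb)
  ... | false | ofⁿ z≢x  = λ { o-exb → z≢x refl ; (o-ex o) → ∉-Subf φ x≢y (x∉b ∘ b-ex) o }

  ≐-subst : (φ : Pattern) → ¬ OccursBound x φ → ¬ Occurs y φ →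
            ⊢ ((var x ≐ var y) ⇒ (φ ⇒ Subf x y φ)) × ⊢ ((var x ≐ var y) ⇒ (Subf x y φ ⇒ φ))
  ≐-subst {x} (var z) _ _ with does (z ≟ x) | proof (z ≟ x)
  ... | true  | ofʸ refl = ≐-elimˡ , ≐-elimʳ
  ... | false | _        = ⇒-const ⇒-refl , ⇒-const ⇒-refl
  ≐-subst (sym s) _ _ = ⇒-const ⇒-refl , ⇒-const ⇒-refl
  ≐-subst ⊥ₚ      _ _ = ⇒-const ⇒-refl , ⇒-const ⇒-refl
  ≐-subst (¬ₚ φ) x∉b y∉ =
    let f , g = ≐-subst φ (x∉b ∘ b-¬) (y∉ ∘ o-¬)
    in ¬-antitoneᴴ g , ¬-antitoneᴴ f
  ≐-subst (φ ⇒ ψ) x∉b y∉ =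
    let f₁ , g₁ = ≐-subst φ (x∉b ∘ b-⇒l) (y∉ ∘ o-⇒l)
        f₂ , g₂ = ≐-subst ψ (x∉b ∘ b-⇒r) (y∉ ∘ o-⇒r)
    in ⇒-monoᴴ g₁ f₂ , ⇒-monoᴴ f₁ g₂
  ≐-subst (φ ∧ₚ ψ) x∉b y∉ =
    let f₁ , g₁ = ≐-subst φ (x∉b ∘ b-∧l) (y∉ ∘ o-∧l)
        f₂ , g₂ = ≐-subst ψ (x∉b ∘ b-∧r) (y∉ ∘ o-∧r)
    in ∧-monoᴴ f₁ f₂ , ∧-monoᴴ g₁ g₂
  ≐-subst (φ ∨ₚ ψ) x∉b y∉ =
    let f₁ , g₁ = ≐-subst φ (x∉b ∘ b-∨l) (y∉ ∘ o-∨l)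
        f₂ , g₂ = ≐-subst ψ (x∉b ∘ b-∨r) (y∉ ∘ o-∨r)
    in ∨-monoᴴ f₁ f₂ , ∨-monoᴴ g₁ g₂
  ≐-subst (φ · ψ) x∉b y∉ =
    let f₁ , g₁ = ≐-subst φ (x∉b ∘ b-·l) (y∉ ∘ o-·l)
        f₂ , g₂ = ≐-subst ψ (x∉b ∘ b-·r) (y∉ ∘ o-·r)
    in ·-monoᴴ f₁ f₂ , ·-monoᴴ g₁ g₂
  ≐-subst {x} (all z φ) x∉b y∉ with does (z ≟ x) | proof (z ≟ x)
  ... | true  | ofʸ refl = ⊥-elim (x∉b b-allb)
  ... | false | ofⁿ z≢x  =
    let f , g = ≐-subst φ (x∉b ∘ b-all) (y∉ ∘ o-all)
        z∉≐   = ∉-≐ z≢x λ { refl → y∉ o-allb }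
    in ∀-monoᴴ z∉≐ f , ∀-monoᴴ z∉≐ g
  ≐-subst {x} (ex z φ) x∉b y∉ with does (z ≟ x) | proof (z ≟ x)
  ... | true  | ofʸ refl = ⊥-elim (x∉b b-exb)
  ... | false | ofⁿ z≢x  =
    let f , g = ≐-subst φ (x∉b ∘ b-ex) (y∉ ∘ o-ex)
        z∉≐   = ∉-≐ z≢x λ { refl → y∉ o-exb }
    in ∃-monoᴴ z∉≐ f , ∃-monoᴴ z∉≐ g

  ∀-rename : (φ : Pattern) → ¬ OccursBound x φ → ¬ Occurs y φ →
             ⊢ (all x φ ⇒ all y (Subf x y φ))
  ∀-rename {x} {y} φ x∉b y∉φ with x ≟ y
  ... | yes refl rewrite Subf-self x φ = ⇒-refl
  ... | no x≢y = syl (ax-∀vac (∉-all (≢-sym x≢y) y∉φ))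
                     (∀-mono (∀-inst x≢y (∉-Subf φ x≢y x∉b) (proj₁ (≐-subst φ x∉b y∉φ))))

  ∀-unrename : (φ : Pattern) → ¬ OccursBound x φ → ¬ Occurs y φ →
               ⊢ (all y (Subf x y φ) ⇒ all x φ)
  ∀-unrename {x} {y} φ x∉b y∉φ with x ≟ y
  ... | yes refl rewrite Subf-self x φ = ⇒-refl
  ... | no x≢y = syl (ax-∀vac (∉-all x≢y (∉-Subf φ x≢y x∉b)))
                     (∀-mono (∀-inst (≢-sym x≢y) y∉φ (syl ≐-sym (proj₂ (≐-subst φ x∉b y∉φ)))))

mainTheorem17 : (Sym : Set) (defd : Sym) → let open MG Sym defd in
    (φ : Pattern) (x y : EVar) →
    ¬ OccursBound x φ → ¬ Occurs y φ →
    (⊢ (all x φ ⇒ all y (Subf x y φ)))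
    × (⊢ (all y (Subf x y φ) ⇒ all x φ))
    × (⊢ (all x φ ⇔ all y (Subf x y φ)))
mainTheorem17 Sym defd φ x y x∉b y∉φ = rename , unrename , ⇔-intro rename unrename
  where
  open MG Sym defd
  rename : ⊢ (all x φ ⇒ all y (Subf x y φ))
  rename = ∀-rename φ x∉b y∉φ
  unrename : ⊢ (all y (Subf x y φ) ⇒ all x φ)
  unrename = ∀-unrename φ x∉b y∉φ
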